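{- Let $a=u/v$ be a rational number with $\gcd(u,v)=1$ and $0<a<1$. Let $p$ be a prime such that $a-1$ is a $p$-adic unit, and let $M$ be the multiplicative order of $p$ modulo $v$. Then the $p$-adic expansion $a-1=\sum_{j\ge0}\alpha_j p^j$, with $\alpha_j\in\{0,\ldots,p-1\}$, is purely periodic: $\alpha_{j+M}=\alpha_j$ for all $j\ge0$. Moreover, for each $j$ with $0\le j\le M-1$, \[ \alpha_j=\left\lfloor \{ -p^{M-1-j}a\}\,p\right\rfloor . \] In particular, if $p>v$, then every digit $\alpha_j$ is nonzero.
   Context: For a real number $x$, $\{x\}=x-\lfloor x\rfloor$ denotes its fractional part. -}

module Defs where

open import Data.Nat using (ℕ; zero; suc; _+_; _*_; _∸_; _^_; _≤_; _<_)
open import Data.Nat.Divisibility using (_∣_)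
open import Data.Integer using (ℤ; +_; ∣_∣)
open import Data.Rational using (ℚ; _/_; _-_; floor; ↥_; ↧ₙ_)
open import Data.Product using (_×_)
open import Relation.Nullary using (¬_)

ℕtoℚ : ℕ → ℚ
ℕtoℚ n = + n / 1

-- fractional part {x} = x - ⌊x⌋  (NOT the stdlib's fracPart, which uses truncation)
frac : ℚ → ℚ
frac x = x - (floor x / 1)

IsPAdicUnit : ℕ → ℚ → Set
IsPAdicUnit p x = ¬ (p ∣ ∣ ↥ x ∣) × ¬ (p ∣ ↧ₙ x)

InPowZp : ℕ → ℕ → ℚ → Set
InPowZp p n x = (p ^ n ∣ ∣ ↥ x ∣) × ¬ (p ∣ ↧ₙ x)

partialSum : ℕ → (ℕ → ℕ) → ℕ → ℕ
partialSum p α zero    = 0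
partialSum p α (suc n) = partialSum p α n + α n * p ^ n

-- x = Σ_{j≥0} α_j p^j as a p-adic expansion: digits in {0,…,p-1} and
-- the partial sums converge p-adically to x, i.e. x - S_n ∈ p^n ℤ_(p) for all n.
IsPAdicExpansion : ℕ → ℚ → (ℕ → ℕ) → Set
IsPAdicExpansion p x α = (∀ j → α j < p) × (∀ n → InPowZp p n (x - ℕtoℚ (partialSum p α n)))

IsMultOrder : ℕ → ℕ → ℕ → Set
IsMultOrder p v M = 1 ≤ M × v ∣ (p ^ M ∸ 1) × (∀ k → 1 ≤ k → k < M → ¬ (v ∣ (p ^ k ∸ 1)))

-- Write a = u/v and w = v - u, so that a - 1 = -w/v with 0 < w < v. Convergence of the
-- expansion says that p^n divides w + S_n v, S_n being the n-th partial sum, so the carries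
-- c_n = (w + S_n v)/p^n are natural numbers with 0 < c_n < v and c_n + α_n v = p c_(n+1).
-- Since p^M ≡ 1 (mod v), this gives c_(n+1) ≡ p^(M-1) c_n (mod v): each carry determines
-- the next, and c_M ≡ p^M c_M ≡ w = c_0, so carries and digits are M-periodic. Multiplying
-- c_(j+1) p^(j+1) = w + S_(j+1) v by p^(M-1-j) gives -p^(M-1-j) u ≡ c_(j+1) (mod v), hence
-- {-p^(M-1-j) a} = c_(j+1)/v and p times it is α_j + c_j/v. Finally α_j = 0 would force
-- c_j = p c_(j+1) ≥ p, which is impossible when p > v.
{-# OPTIONS --safe #-}
module Submission where

open import Defs

open import Data.Nat as ℕ
  using (ℕ; zero; suc; NonZero; _+_; _*_; _∸_; _^_; _<_; _≤_; _%_; z≤n; s≤s)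
import Data.Nat.Properties as ℕP
open import Data.Nat.DivMod using ([m+kn]%n≡m%n; m<n⇒m%n≡m)
open import Data.Nat.Divisibility using (_∣_; divides; ∣-trans)
open import Data.Nat.Coprimality using (Coprime; coprime-divisor; recompute)
open import Data.Nat.Primality using (Prime; prime⇒nonZero)
import Data.Nat.Tactic.RingSolver as ℕ-Solver
open import Data.Integer as ℤ using (ℤ; +_; -[1+_]; +<+)
import Data.Integer.Properties as ℤP
open import Data.Integer.DivMod using (a≡a%ℕn+[a/ℕn]*n; n%ℕd<d; div-pos-is-/ℕ)
import Data.Integer.Tactic.RingSolver as ℤ-Solver
open import Data.Rational as ℚ
  using (ℚ; mkℚ; 0ℚ; 1ℚ; _-_; -_; floor; toℚᵘ; ↥_; ↧ₙ_; *<*)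
  renaming (_<_ to _<ℚ_; _*_ to _*ℚ_)
open import Data.Rational.Properties
  using (toℚᵘ-homo-+; toℚᵘ-homo‿-; toℚᵘ-homo-*; toℚᵘ-fromℚᵘ)
open import Data.Rational.Unnormalised as ℚᵘ using (*≡*) renaming (_≃_ to _≃ᵘ_)
import Data.Rational.Unnormalised.Properties as ℚᵘP
open import Data.Product using (_×_; _,_; proj₁; ∃-syntax)
open import Relation.Binary.Definitions using (tri<; tri≈; tri>)
open import Relation.Binary.PropositionalEquality
open import Relation.Nullary using (contradiction)

pos-+-* : ∀ x y z → + (x + y * z) ≡ + x ℤ.+ + y ℤ.* + z
pos-+-* x y z = trans (ℤP.pos-+ x (y * z)) (cong (ℤ._+_ (+ x)) (ℤP.pos-* y z))

quotient-<⇒< : ∀ {d r r′ : ℕ} {q q′ : ℤ} → r < d → q ℤ.< q′ →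
               + r ℤ.+ q ℤ.* + d ℤ.< + r′ ℤ.+ q′ ℤ.* + d
quotient-<⇒< {d} {r} {r′} {q} {q′} r<d q<q′ = begin-strict
  + r ℤ.+ q ℤ.* + d    <⟨ ℤP.+-monoˡ-< (q ℤ.* + d) (+<+ r<d) ⟩
  + d ℤ.+ q ℤ.* + d    ≡⟨ ℤP.suc-* q (+ d) ⟨
  ℤ.suc q ℤ.* + d      ≤⟨ ℤP.*-monoʳ-≤-nonNeg (+ d) (ℤP.i<j⇒suc[i]≤j q<q′) ⟩
  q′ ℤ.* + d           ≤⟨ ℤP.i≤j+i (q′ ℤ.* + d) (+ r′) ⟩
  + r′ ℤ.+ q′ ℤ.* + d  ∎
  where open ℤP.≤-Reasoning

quotient-unique : ∀ {d r r′ : ℕ} {q q′ : ℤ} → r < d → r′ < d →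
                  + r ℤ.+ q ℤ.* + d ≡ + r′ ℤ.+ q′ ℤ.* + d → q ≡ q′
quotient-unique {q = q} {q′} r<d r′<d eq with ℤP.<-cmp q q′
... | tri< q<q′ _ _ = contradiction eq (ℤP.<⇒≢ (quotient-<⇒< r<d q<q′))
... | tri≈ _ q≡q′ _ = q≡q′
... | tri> _ _ q′<q = contradiction (sym eq) (ℤP.<⇒≢ (quotient-<⇒< r′<d q′<q))

-- Cross-multiplying by d′ turns both sides into divisions with remainder by d * d′.
fraction-quotient-unique : ∀ {d d′ r r′ : ℕ} {q q′ : ℤ} .{{_ : NonZero d}} .{{_ : NonZero d′}} →
  r < d → r′ < d′ → (+ r ℤ.+ q ℤ.* + d) ℤ.* + d′ ≡ (+ r′ ℤ.+ q′ ℤ.* + d′) ℤ.* + d → q ≡ q′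
fraction-quotient-unique {d} {d′} {r} {r′} {q} {q′} r<d r′<d′ eq =
  quotient-unique (ℕP.*-monoˡ-< d′ r<d) r′d<dd′ (begin
    + (r * d′) ℤ.+ q ℤ.* + (d * d′)     ≡⟨ scale r q d d′ ⟨
    (+ r ℤ.+ q ℤ.* + d) ℤ.* + d′         ≡⟨ eq ⟩
    (+ r′ ℤ.+ q′ ℤ.* + d′) ℤ.* + d       ≡⟨ scale r′ q′ d′ d ⟩
    + (r′ * d) ℤ.+ q′ ℤ.* + (d′ * d)     ≡⟨ cong (λ e → + (r′ * d) ℤ.+ q′ ℤ.* + e) (ℕP.*-comm d′ d) ⟩
    + (r′ * d) ℤ.+ q′ ℤ.* + (d * d′)     ∎)
  where
  open ≡-Reasoning
  r′d<dd′ : r′ * d < d * d′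
  r′d<dd′ = subst (r′ * d <_) (ℕP.*-comm d′ d) (ℕP.*-monoˡ-< d r′<d′)
  distrib : ∀ r q d d′ → (r ℤ.+ q ℤ.* d) ℤ.* d′ ≡ r ℤ.* d′ ℤ.+ q ℤ.* (d ℤ.* d′)
  distrib = ℤ-Solver.solve-∀
  scale : ∀ r q d d′ → (+ r ℤ.+ q ℤ.* + d) ℤ.* + d′ ≡ + (r * d′) ℤ.+ q ℤ.* + (d * d′)
  scale r q d d′ = trans (distrib (+ r) q (+ d) (+ d′))
    (sym (cong₂ (λ x y → x ℤ.+ q ℤ.* y) (ℤP.pos-* r d′) (ℤP.pos-* d d′)))

x+[y+av]≡bv⇒-x≡y+[a-b]v : ∀ x y a b v → x + (y + a * v) ≡ b * v → ℤ.- + x ≡ + y ℤ.+ (+ a ℤ.- + b) ℤ.* + v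
x+[y+av]≡bv⇒-x≡y+[a-b]v x y a b v eq = begin
  ℤ.- + x                                     ≡⟨ negate-summand (+ x) (+ y ℤ.+ + a ℤ.* + v) _ eqℤ ⟩
  (+ y ℤ.+ + a ℤ.* + v) ℤ.- + b ℤ.* + v      ≡⟨ factor (+ y) (+ a) (+ b) (+ v) ⟩
  + y ℤ.+ (+ a ℤ.- + b) ℤ.* + v              ∎
  where
  open ≡-Reasoning
  eqℤ : + x ℤ.+ (+ y ℤ.+ + a ℤ.* + v) ≡ + b ℤ.* + v
  eqℤ = begin
    + x ℤ.+ (+ y ℤ.+ + a ℤ.* + v)   ≡⟨ cong (ℤ._+_ (+ x)) (pos-+-* y a v) ⟨
    + x ℤ.+ + (y + a * v)           ≡⟨ ℤP.pos-+ x _ ⟨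
    + (x + (y + a * v))             ≡⟨ cong +_ eq ⟩
    + (b * v)                       ≡⟨ ℤP.pos-* b v ⟩
    + b ℤ.* + v                     ∎
  negate-summand : ∀ x r t → x ℤ.+ r ≡ t → ℤ.- x ≡ r ℤ.- t
  negate-summand x r _ refl = identity x r
    where
    identity : ∀ x r → ℤ.- x ≡ r ℤ.- (x ℤ.+ r)
    identity = ℤ-Solver.solve-∀
  factor : ∀ y a b v → (y ℤ.+ a ℤ.* v) ℤ.- b ℤ.* v ≡ y ℤ.+ (a ℤ.- b) ℤ.* v
  factor = ℤ-Solver.solve-∀

remainder-unique : ∀ {v x y a b} .{{_ : NonZero v}} → x < v → y < v → x + a * v ≡ y + b * v → x ≡ y
remainder-unique {v} {x} {y} {a} {b} x<v y<v eq = begin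
  x                ≡⟨ m<n⇒m%n≡m x<v ⟨
  x % v            ≡⟨ [m+kn]%n≡m%n x a v ⟨
  (x + a * v) % v  ≡⟨ cong (_% v) eq ⟩
  (y + b * v) % v  ≡⟨ [m+kn]%n≡m%n y b v ⟩
  y % v            ≡⟨ m<n⇒m%n≡m y<v ⟩
  y                ∎
  where open ≡-Reasoning

toℚᵘ-/1 : ∀ z → toℚᵘ (z ℚ./ 1) ≃ᵘ z ℚᵘ./ 1
toℚᵘ-/1 z = toℚᵘ-fromℚᵘ (z ℚᵘ./ 1)

/-+-/1 : ∀ n z d .{{_ : NonZero d}} → n ℚᵘ./ d ℚᵘ.+ z ℚᵘ./ 1 ≃ᵘ (n ℤ.+ z ℤ.* + d) ℚᵘ./ d
/-+-/1 n z d@(suc _) = *≡* (cong₂ ℤ._*_ (cong (ℤ._+ z ℤ.* + d) (ℤP.*-identityʳ n))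
                                        (cong +_ (sym (ℕP.*-identityʳ d))))

/-*-/1 : ∀ n z d .{{_ : NonZero d}} → (n ℚᵘ./ d) ℚᵘ.* (z ℚᵘ./ 1) ≃ᵘ (n ℤ.* z) ℚᵘ./ d
/-*-/1 n z d@(suc _) = *≡* (cong ((n ℤ.* z) ℤ.*_) (cong +_ (sym (ℕP.*-identityʳ d))))

∣↥∣∣∣numerator∣ : ∀ x n d .{{_ : NonZero d}} → toℚᵘ x ≃ᵘ n ℚᵘ./ d → ℤ.∣ ↥ x ∣ ∣ ℤ.∣ n ∣
∣↥∣∣∣numerator∣ (mkℚ X e-1 coprime) n d@(suc _) (*≡* eq) =
  coprime-divisor (recompute coprime) (divides d (begin
    suc e-1 * ℤ.∣ n ∣       ≡⟨ ℕP.*-comm (suc e-1) _ ⟩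
    ℤ.∣ n ∣ * suc e-1       ≡⟨ ℤP.abs-* n (+ suc e-1) ⟨
    ℤ.∣ n ℤ.* + suc e-1 ∣   ≡⟨ cong ℤ.∣_∣ eq ⟨
    ℤ.∣ X ℤ.* + d ∣         ≡⟨ ℤP.abs-* X (+ d) ⟩
    ℤ.∣ X ∣ * d             ≡⟨ ℕP.*-comm _ d ⟩
    d * ℤ.∣ X ∣             ∎))
  where open ≡-Reasoning

floor-≃ : ∀ x {d r} q .{{_ : NonZero d}} → r < d →
          toℚᵘ x ≃ᵘ (+ r ℤ.+ q ℤ.* + d) ℚᵘ./ d → floor x ≡ q
floor-≃ (mkℚ X e-1 _) {d@(suc _)} q r<d (*≡* eq) = begin
  X ℤ./ + suc e-1   ≡⟨ div-pos-is-/ℕ X (suc e-1) ⟩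
  X ℤ./ℕ suc e-1    ≡⟨ fraction-quotient-unique (n%ℕd<d X (suc e-1)) r<d
                        (trans (cong (ℤ._* + d) (sym (a≡a%ℕn+[a/ℕn]*n X (suc e-1)))) eq) ⟩
  q                 ∎
  where open ≡-Reasoning

frac-≃ : ∀ x {d r} q .{{_ : NonZero d}} → r < d →
         toℚᵘ x ≃ᵘ (+ r ℤ.+ q ℤ.* + d) ℚᵘ./ d → toℚᵘ (frac x) ≃ᵘ + r ℚᵘ./ d
frac-≃ x {d} {r} q r<d x≃ = begin
  toℚᵘ (x ℚ.+ - (floor x ℚ./ 1))                       ≈⟨ toℚᵘ-homo-+ x _ ⟩
  toℚᵘ x ℚᵘ.+ toℚᵘ (- (floor x ℚ./ 1))                 ≈⟨ ℚᵘP.+-cong x≃ (ℚᵘP.≃-trans (toℚᵘ-homo‿- _)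
                                                                             (ℚᵘP.-‿cong (toℚᵘ-/1 _))) ⟩
  (+ r ℤ.+ q ℤ.* + d) ℚᵘ./ d ℚᵘ.+ ℤ.- floor x ℚᵘ./ 1   ≡⟨ cong (λ z → (+ r ℤ.+ q ℤ.* + d) ℚᵘ./ d ℚᵘ.+ ℤ.- z ℚᵘ./ 1)
                                                                (floor-≃ x q r<d x≃) ⟩
  (+ r ℤ.+ q ℤ.* + d) ℚᵘ./ d ℚᵘ.+ ℤ.- q ℚᵘ./ 1         ≈⟨ /-+-/1 _ (ℤ.- q) d ⟩
  (+ r ℤ.+ q ℤ.* + d ℤ.+ ℤ.- q ℤ.* + d) ℚᵘ./ d         ≡⟨ cong (ℚᵘ._/ d) (cancel (+ r) q (+ d)) ⟩
  + r ℚᵘ./ d                                            ∎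
  where
  open ℚᵘP.≃-Reasoning
  cancel : ∀ r q d → r ℤ.+ q ℤ.* d ℤ.+ ℤ.- q ℤ.* d ≡ r
  cancel = ℤ-Solver.solve-∀

floor[frac*p]≡digit : ∀ y {v c c′ α p} (z : ℤ) .{{_ : NonZero v}} → c < v → c′ < v →
  toℚᵘ y ≃ᵘ (+ c′ ℤ.+ z ℤ.* + v) ℚᵘ./ v → c + α * v ≡ p * c′ → floor (frac y *ℚ ℕtoℚ p) ≡ + α
floor[frac*p]≡digit y {v} {c} {c′} {α} {p} z c<v c′<v y≃ c+αv≡pc′ = floor-≃ _ (+ α) c<v (begin
  toℚᵘ (frac y *ℚ ℕtoℚ p)              ≈⟨ toℚᵘ-homo-* (frac y) (ℕtoℚ p) ⟩
  toℚᵘ (frac y) ℚᵘ.* toℚᵘ (ℕtoℚ p)     ≈⟨ ℚᵘP.*-cong (frac-≃ y z c′<v y≃) (toℚᵘ-/1 (+ p)) ⟩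
  (+ c′ ℚᵘ./ v) ℚᵘ.* (+ p ℚᵘ./ 1)      ≈⟨ /-*-/1 (+ c′) (+ p) v ⟩
  (+ c′ ℤ.* + p) ℚᵘ./ v                 ≡⟨ cong (ℚᵘ._/ v) numerator ⟩
  (+ c ℤ.+ + α ℤ.* + v) ℚᵘ./ v          ∎)
  where
  open ℚᵘP.≃-Reasoning
  numerator : + c′ ℤ.* + p ≡ + c ℤ.+ + α ℤ.* + v
  numerator = trans (sym (ℤP.pos-* c′ p))
                    (trans (cong +_ (trans (ℕP.*-comm c′ p) (sym c+αv≡pc′))) (pos-+-* c α v))

partialSum<p^n : ∀ {p α} → (∀ j → α j < p) → ∀ n → partialSum p α n < p ^ n
partialSum<p^n α<p zero = s≤s z≤n
partialSum<p^n {p} {α} α<p (suc n) = begin-strict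
  partialSum p α n + α n * p ^ n  <⟨ ℕP.+-monoˡ-< (α n * p ^ n) (partialSum<p^n α<p n) ⟩
  suc (α n) * p ^ n               ≤⟨ ℕP.*-monoˡ-≤ (p ^ n) (α<p n) ⟩
  p ^ suc n                       ∎
  where open ℕP.≤-Reasoning

-- -carry n / v is the tail Σ_{j ≥ n} α j p^(j - n) of the expansion of -w/v.
module Carries (p v w : ℕ) .{{_ : NonZero p}} .{{_ : NonZero v}} (w<v : w < v) (0<w : 0 < w)
  (α : ℕ → ℕ) (α<p : ∀ j → α j < p) (p^n∣ : ∀ n → p ^ n ∣ w + partialSum p α n * v) where

  S : ℕ → ℕ
  S = partialSum p α

  carry : ℕ → ℕ
  carry n = _∣_.quotient (p^n∣ n)

  carry-spec : ∀ n → w + S n * v ≡ carry n * p ^ n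
  carry-spec n = _∣_.equality (p^n∣ n)

  carry-0 : carry 0 ≡ w
  carry-0 = begin
    carry 0      ≡⟨ ℕP.*-identityʳ (carry 0) ⟨
    carry 0 * 1  ≡⟨ carry-spec 0 ⟨
    w + 0        ≡⟨ ℕP.+-identityʳ w ⟩
    w            ∎
    where open ≡-Reasoning

  carry<v : ∀ n → carry n < v
  carry<v n = ℕP.*-cancelʳ-< (p ^ n) (carry n) v (begin-strict
    carry n * p ^ n  ≡⟨ carry-spec n ⟨
    w + S n * v      <⟨ ℕP.+-monoˡ-< (S n * v) w<v ⟩
    suc (S n) * v    ≤⟨ ℕP.*-monoˡ-≤ v (partialSum<p^n α<p n) ⟩
    p ^ n * v        ≡⟨ ℕP.*-comm (p ^ n) v ⟩
    v * p ^ n        ∎)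
    where open ℕP.≤-Reasoning

  carry-pos : ∀ n → 0 < carry n
  carry-pos n = ℕP.n≢0⇒n>0 λ carry≡0 → ℕP.>⇒≢ 0<w (ℕP.n≤0⇒n≡0 (begin
    w                ≤⟨ ℕP.m≤m+n w (S n * v) ⟩
    w + S n * v      ≡⟨ carry-spec n ⟩
    carry n * p ^ n  ≡⟨ cong (_* p ^ n) carry≡0 ⟩
    0                ∎))
    where open ℕP.≤-Reasoning

  carry-step : ∀ n → carry n + α n * v ≡ p * carry (suc n)
  carry-step n = ℕP.*-cancelʳ-≡ _ _ (p ^ n) {{ℕP.m^n≢0 p n}} (begin
    (carry n + α n * v) * p ^ n               ≡⟨ ℕP.*-distribʳ-+ (p ^ n) (carry n) (α n * v) ⟩
    carry n * p ^ n + α n * v * p ^ n         ≡⟨ cong (_+ α n * v * p ^ n) (carry-spec n) ⟨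
    w + S n * v + α n * v * p ^ n             ≡⟨ regroup w (S n) v (α n) (p ^ n) ⟩
    w + S (suc n) * v                          ≡⟨ carry-spec (suc n) ⟩
    carry (suc n) * (p * p ^ n)               ≡⟨ ℕP.*-assoc (carry (suc n)) p (p ^ n) ⟨
    carry (suc n) * p * p ^ n                 ≡⟨ cong (_* p ^ n) (ℕP.*-comm (carry (suc n)) p) ⟩
    p * carry (suc n) * p ^ n                 ∎)
    where
    open ≡-Reasoning
    regroup : ∀ w s v a P → w + s * v + a * v * P ≡ w + (s + a * P) * v
    regroup = ℕ-Solver.solve-∀

  digit-determined : ∀ {m n} → carry m ≡ carry n → carry (suc m) ≡ carry (suc n) → α m ≡ α n
  digit-determined {m} {n} cₘ≡cₙ cₘ₊₁≡cₙ₊₁ =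
    ℕP.*-cancelʳ-≡ (α m) (α n) v (ℕP.+-cancelˡ-≡ (carry m) _ _ (begin
      carry m + α m * v        ≡⟨ carry-step m ⟩
      p * carry (suc m)        ≡⟨ cong (p *_) cₘ₊₁≡cₙ₊₁ ⟩
      p * carry (suc n)        ≡⟨ carry-step n ⟨
      carry n + α n * v        ≡⟨ cong (_+ α n * v) cₘ≡cₙ ⟨
      carry m + α n * v        ∎))
    where open ≡-Reasoning

  digit-pos : v ≤ p → ∀ j → 0 < α j
  digit-pos v≤p j = ℕP.n≢0⇒n>0 λ αj≡0 → ℕP.<-irrefl refl (begin-strict
    carry j            <⟨ carry<v j ⟩
    v                  ≤⟨ v≤p ⟩
    p                  ≤⟨ ℕP.m≤m*n p (carry (suc j)) {{ℕ.>-nonZero (carry-pos (suc j))}} ⟩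
    p * carry (suc j)  ≡⟨ carry-step j ⟨
    carry j + α j * v  ≡⟨ cong (λ a → carry j + a * v) αj≡0 ⟩
    carry j + 0 * v    ≡⟨ ℕP.+-identityʳ (carry j) ⟩
    carry j            ∎)
    where open ℕP.≤-Reasoning

  module Periodic (M′ k : ℕ) (p^M≡1+kv : p ^ suc M′ ≡ 1 + k * v) where

    p^M*x≡x+kx*v : ∀ x → p ^ suc M′ * x ≡ x + k * x * v
    p^M*x≡x+kx*v x = trans (cong (_* x) p^M≡1+kv) (expand k v x)
      where
      expand : ∀ k v x → (1 + k * v) * x ≡ x + k * x * v
      expand = ℕ-Solver.solve-∀

    p^e*[w+Sv]≡carry+k*carry*v : ∀ e n → e + n ≡ suc M′ → p ^ e * (w + S n * v) ≡ carry n + k * carry n * v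
    p^e*[w+Sv]≡carry+k*carry*v e n e+n≡M = begin
      p ^ e * (w + S n * v)      ≡⟨ cong (p ^ e *_) (carry-spec n) ⟩
      p ^ e * (carry n * p ^ n)  ≡⟨ rearrange (p ^ e) (carry n) (p ^ n) ⟩
      p ^ e * p ^ n * carry n    ≡⟨ cong (_* carry n) (ℕP.^-distribˡ-+-* p e n) ⟨
      p ^ (e + n) * carry n      ≡⟨ cong (λ i → p ^ i * carry n) e+n≡M ⟩
      p ^ suc M′ * carry n       ≡⟨ p^M*x≡x+kx*v (carry n) ⟩
      carry n + k * carry n * v  ∎
      where
      open ≡-Reasoning
      rearrange : ∀ a c b → a * (c * b) ≡ a * b * c
      rearrange = ℕ-Solver.solve-∀

    carry-M : carry (suc M′) ≡ w
    carry-M = remainder-unique {a = k * carry (suc M′)} {b = S (suc M′)} (carry<v (suc M′)) w<v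
      (trans (sym (p^e*[w+Sv]≡carry+k*carry*v 0 (suc M′) refl)) (ℕP.*-identityˡ _))

    carry-suc : ∀ n → carry (suc n) ≡ (p ^ M′ * carry n) % v
    carry-suc n = begin
      carry (suc n)                                ≡⟨ m<n⇒m%n≡m (carry<v (suc n)) ⟨
      carry (suc n) % v                            ≡⟨ [m+kn]%n≡m%n (carry (suc n)) (k * carry (suc n)) v ⟨
      (carry (suc n) + k * carry (suc n) * v) % v  ≡⟨ cong (_% v) (p^M*x≡x+kx*v (carry (suc n))) ⟨
      (p * p ^ M′ * carry (suc n)) % v             ≡⟨ cong (_% v) (swap p (p ^ M′) (carry (suc n))) ⟩
      (p ^ M′ * (p * carry (suc n))) % v           ≡⟨ cong (λ x → (p ^ M′ * x) % v) (carry-step n) ⟨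
      (p ^ M′ * (carry n + α n * v)) % v           ≡⟨ cong (_% v) (distrib (p ^ M′) (carry n) (α n) v) ⟩
      (p ^ M′ * carry n + p ^ M′ * α n * v) % v    ≡⟨ [m+kn]%n≡m%n (p ^ M′ * carry n) (p ^ M′ * α n) v ⟩
      (p ^ M′ * carry n) % v                       ∎
      where
      open ≡-Reasoning
      swap : ∀ p P c → p * P * c ≡ P * (p * c)
      swap = ℕ-Solver.solve-∀
      distrib : ∀ P c a v → P * (c + a * v) ≡ P * c + P * a * v
      distrib = ℕ-Solver.solve-∀

    carry-periodic : ∀ n → carry (n + suc M′) ≡ carry n
    carry-periodic zero    = trans carry-M (sym carry-0)
    carry-periodic (suc n) = begin
      carry (suc (n + suc M′))          ≡⟨ carry-suc (n + suc M′) ⟩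
      (p ^ M′ * carry (n + suc M′)) % v ≡⟨ cong (λ c → (p ^ M′ * c) % v) (carry-periodic n) ⟩
      (p ^ M′ * carry n) % v            ≡⟨ carry-suc n ⟨
      carry (suc n)                     ∎
      where open ≡-Reasoning

    digit-periodic : ∀ n → α (n + suc M′) ≡ α n
    digit-periodic n = digit-determined (carry-periodic n) (carry-periodic (suc n))

    negated-numerator : ∀ {u} → u + w ≡ v → ∀ j → j < suc M′ →
                        ∃[ z ] ℤ.- + (p ^ (M′ ∸ j) * u) ≡ + carry (suc j) ℤ.+ z ℤ.* + v
    negated-numerator {u} u+w≡v j (s≤s j≤M′) =
      + (k * c) ℤ.- + (m + m * S′) , x+[y+av]≡bv⇒-x≡y+[a-b]v (m * u) c (k * c) (m + m * S′) v (begin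
        m * u + (c + k * c * v)   ≡⟨ cong (_+_ (m * u)) (p^e*[w+Sv]≡carry+k*carry*v (M′ ∸ j) (suc j) e+[1+j]≡M) ⟨
        m * u + m * (w + S′ * v)  ≡⟨ rearrange m u w S′ v u+w≡v ⟩
        (m + m * S′) * v          ∎)
      where
      open ≡-Reasoning
      m = p ^ (M′ ∸ j)
      c = carry (suc j)
      S′ = S (suc j)
      e+[1+j]≡M : M′ ∸ j + suc j ≡ suc M′
      e+[1+j]≡M = trans (ℕP.+-suc (M′ ∸ j) j) (cong suc (ℕP.m∸n+n≡m j≤M′))
      rearrange : ∀ m u w s v → u + w ≡ v → m * u + m * (w + s * v) ≡ (m + m * s) * v
      rearrange m u w s _ refl = identity m u w s
        where
        identity : ∀ m u w s → m * u + m * (w + s * (u + w)) ≡ (m + m * s) * (u + w)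
        identity = ℕ-Solver.solve-∀

0<numerator : ∀ {u v-1} .{cop : Coprime u (suc v-1)} → 0ℚ <ℚ mkℚ (+ u) v-1 cop → 0 < u
0<numerator (*<* 0<u*1) = ℤP.drop‿+<+ (subst (+ 0 ℤ.<_) (ℤP.*-identityʳ _) 0<u*1)

numerator<denominator : ∀ {u v-1} .{cop : Coprime u (suc v-1)} → mkℚ (+ u) v-1 cop <ℚ 1ℚ → u < suc v-1
numerator<denominator (*<* u*1<1*v) =
  ℤP.drop‿+<+ (subst₂ ℤ._<_ (ℤP.*-identityʳ _) (ℤP.*-identityˡ _) u*1<1*v)

a-1-s≃-[w+sv]/v : ∀ {a u w v} .{{_ : NonZero v}} s → toℚᵘ a ≃ᵘ + u ℚᵘ./ v → u + w ≡ v →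
                  toℚᵘ ((a - 1ℚ) - ℕtoℚ s) ≃ᵘ ℤ.- + (w + s * v) ℚᵘ./ v
a-1-s≃-[w+sv]/v {a} {u} {w} {v} s a≃u/v u+w≡v = begin
  toℚᵘ ((a - 1ℚ) - ℕtoℚ s)                             ≈⟨ toℚᵘ-homo-+ (a - 1ℚ) (- ℕtoℚ s) ⟩
  toℚᵘ (a - 1ℚ) ℚᵘ.+ toℚᵘ (- ℕtoℚ s)                   ≈⟨ ℚᵘP.+-cong a-1≃ -s≃ ⟩
  (+ u ℤ.+ ℤ.-1ℤ ℤ.* + v) ℚᵘ./ v ℚᵘ.+ ℤ.- + s ℚᵘ./ 1   ≈⟨ /-+-/1 _ (ℤ.- + s) v ⟩
  (+ u ℤ.+ ℤ.-1ℤ ℤ.* + v ℤ.+ ℤ.- + s ℤ.* + v) ℚᵘ./ v   ≡⟨ cong (ℚᵘ._/ v) numerator ⟩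
  ℤ.- + (w + s * v) ℚᵘ./ v                             ∎
  where
  open ℚᵘP.≃-Reasoning
  a-1≃ : toℚᵘ (a - 1ℚ) ≃ᵘ (+ u ℤ.+ ℤ.-1ℤ ℤ.* + v) ℚᵘ./ v
  a-1≃ = ℚᵘP.≃-trans (toℚᵘ-homo-+ a (- 1ℚ)) (ℚᵘP.≃-trans (ℚᵘP.+-cong a≃u/v ℚᵘP.≃-refl) (/-+-/1 (+ u) ℤ.-1ℤ v))
  -s≃ : toℚᵘ (- ℕtoℚ s) ≃ᵘ ℤ.- + s ℚᵘ./ 1
  -s≃ = ℚᵘP.≃-trans (toℚᵘ-homo‿- _) (ℚᵘP.-‿cong (toℚᵘ-/1 (+ s)))
  identity : ∀ u w s v → v ≡ u ℤ.+ w → u ℤ.+ ℤ.-1ℤ ℤ.* v ℤ.+ ℤ.- s ℤ.* v ≡ ℤ.- (w ℤ.+ s ℤ.* v)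
  identity u w s _ refl = solution u w s
    where
    solution : ∀ u w s → u ℤ.+ ℤ.-1ℤ ℤ.* (u ℤ.+ w) ℤ.+ ℤ.- s ℤ.* (u ℤ.+ w) ≡ ℤ.- (w ℤ.+ s ℤ.* (u ℤ.+ w))
    solution = ℤ-Solver.solve-∀
  numerator : + u ℤ.+ ℤ.-1ℤ ℤ.* + v ℤ.+ ℤ.- + s ℤ.* + v ≡ ℤ.- + (w + s * v)
  numerator = trans (identity (+ u) (+ w) (+ s) (+ v) (trans (cong +_ (sym u+w≡v)) (ℤP.pos-+ u w)))
                    (cong ℤ.-_ (sym (pos-+-* w s v)))

expansion⇒p^n∣ : ∀ {p a u w v α} .{{_ : NonZero v}} → toℚᵘ a ≃ᵘ + u ℚᵘ./ v → u + w ≡ v →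
                 IsPAdicExpansion p (a - 1ℚ) α → ∀ n → p ^ n ∣ w + partialSum p α n * v
expansion⇒p^n∣ {p} {a} {u} {w} {v} {α} a≃u/v u+w≡v (_ , converges) n =
  ∣-trans (proj₁ (converges n))
    (subst (ℤ.∣ ↥ x ∣ ∣_) (ℤP.∣-i∣≡∣i∣ (+ (w + s * v)))
      (∣↥∣∣∣numerator∣ x _ v (a-1-s≃-[w+sv]/v s a≃u/v u+w≡v)))
  where
  s = partialSum p α n
  x = (a - 1ℚ) - ℕtoℚ s

toℚᵘ-[-m*a] : ∀ m {a u v} .{{_ : NonZero v}} → toℚᵘ a ≃ᵘ + u ℚᵘ./ v →
              toℚᵘ (- (ℕtoℚ m *ℚ a)) ≃ᵘ ℤ.- + (m * u) ℚᵘ./ v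
toℚᵘ-[-m*a] m {a} {u} {v@(suc _)} a≃u/v = ℚᵘP.≃-trans (toℚᵘ-homo‿- _) (ℚᵘP.-‿cong (begin
  toℚᵘ (ℕtoℚ m *ℚ a)               ≈⟨ toℚᵘ-homo-* (ℕtoℚ m) a ⟩
  toℚᵘ (ℕtoℚ m) ℚᵘ.* toℚᵘ a        ≈⟨ ℚᵘP.*-cong (toℚᵘ-/1 (+ m)) a≃u/v ⟩
  (+ m ℚᵘ./ 1) ℚᵘ.* (+ u ℚᵘ./ v)   ≈⟨ ℚᵘP.*-comm (+ m ℚᵘ./ 1) (+ u ℚᵘ./ v) ⟩
  (+ u ℚᵘ./ v) ℚᵘ.* (+ m ℚᵘ./ 1)   ≈⟨ /-*-/1 (+ u) (+ m) v ⟩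
  (+ u ℤ.* + m) ℚᵘ./ v             ≡⟨ cong (ℚᵘ._/ v) (trans (sym (ℤP.pos-* u m)) (cong +_ (ℕP.*-comm u m))) ⟩
  + (m * u) ℚᵘ./ v                 ∎))
  where open ℚᵘP.≃-Reasoning

lemma3p1 : (a : ℚ) → 0ℚ <ℚ a → a <ℚ 1ℚ → (p : ℕ) → Prime p → IsPAdicUnit p (a - 1ℚ)
    → (M : ℕ) → IsMultOrder p (↧ₙ a) M
    → (α : ℕ → ℕ) → IsPAdicExpansion p (a - 1ℚ) α
    → ((j : ℕ) → α (j + M) ≡ α j)
    × ((j : ℕ) → j < M → + (α j) ≡ floor (frac (- (ℕtoℚ (p ^ (M ∸ 1 ∸ j)) *ℚ a)) *ℚ ℕtoℚ p))
    × (↧ₙ a < p → (j : ℕ) → 0 < α j)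
lemma3p1 (mkℚ -[1+ _ ] _ _) (*<* ())
lemma3p1 _ _ _ _ _ _ zero (() , _)
lemma3p1 a@(mkℚ (+ u) v-1 _) 0<a a<1 p p-prime _ (suc M′) (_ , divides k p^M∸1≡kv , _) α expansion =
  digit-periodic , digit-formula , λ v<p → digit-pos (ℕP.<⇒≤ v<p)
  where
  instance
    p≢0 : NonZero p
    p≢0 = prime⇒nonZero p-prime
  v w : ℕ
  v = suc v-1
  w = v ∸ u
  u<v : u < v
  u<v = numerator<denominator a<1
  u+w≡v : u + w ≡ v
  u+w≡v = ℕP.m+[n∸m]≡n (ℕP.<⇒≤ u<v)
  p^M≡1+kv : p ^ suc M′ ≡ 1 + k * v
  p^M≡1+kv = trans (sym (ℕP.m+[n∸m]≡n (ℕP.m^n>0 p (suc M′)))) (cong suc p^M∸1≡kv)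
  open Carries p v w (ℕP.∸-monoʳ-< (0<numerator 0<a) (ℕP.<⇒≤ u<v)) (ℕP.m<n⇒0<n∸m u<v)
               α (proj₁ expansion) (expansion⇒p^n∣ {a = a} ℚᵘP.≃-refl u+w≡v expansion)
  open Periodic M′ k p^M≡1+kv
  digit-formula : ∀ j → j < suc M′ → + α j ≡ floor (frac (- (ℕtoℚ (p ^ (M′ ∸ j)) *ℚ a)) *ℚ ℕtoℚ p)
  digit-formula j j<M with negated-numerator u+w≡v j j<M
  ... | z , -mu≡c+zv =
    sym (floor[frac*p]≡digit _ {p = p} z (carry<v j) (carry<v (suc j)) y≃ (carry-step j))
    where
    y≃ : toℚᵘ (- (ℕtoℚ (p ^ (M′ ∸ j)) *ℚ a)) ≃ᵘ (+ carry (suc j) ℤ.+ z ℤ.* + v) ℚᵘ./ v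
    y≃ = ℚᵘP.≃-trans (toℚᵘ-[-m*a] (p ^ (M′ ∸ j)) ℚᵘP.≃-refl) (ℚᵘP.≃-reflexive (cong (ℚᵘ._/ v) -mu≡c+zv))
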